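{- Let $p$ be a prime and $s\ge1$, $n,m\ge1$, $j$ integers. Then \[ E(n\times m,p^s,p^j)=E(n\times m,p^{s-1},p^{j-m})+\tilde E(n\times m,p^s,p^j). \]
   Context: For $t\ge0$, $\mathbb{Z}_{p^t}$ is the ring of integers modulo $p^t$ ($\mathbb{Z}_{p^0}=\mathbb{Z}_1$ is the zero ring, whose unique $n\times m$ matrix has exactly one solution). $E(n\times m,p^t,p^j)$ is the number of $n\times m$ matrices $A$ over $\mathbb{Z}_{p^t}$ such that $Ax\equiv0\pmod{p^t}$ has exactly $p^j$ solutions $x\in\mathbb{Z}_{p^t}^m$; it is $0$ if $j<0$. A matrix over $\mathbb{Z}_{p^s}$ is relatively prime if at least one entry is invertible modulo $p^s$ (not divisible by $p$). $\tilde E(n\times m,p^s,p^j)$ is the number of relatively prime $n\times m$ matrices over $\mathbb{Z}_{p^s}$ such that $Ax\equiv0\pmod{p^s}$ has exactly $p^j$ solutions. -}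

module Defs where

open import Data.Nat using (ℕ; zero; suc; _+_; _*_; _^_; _≟_)
open import Data.Nat.Divisibility using (_∣_; _∣?_)
open import Data.Integer using (ℤ; +_; -[1+_])
open import Data.Fin using (Fin; toℕ)
open import Data.Fin.Properties using (any?; all?)
open import Data.List using (List; []; _∷_; map; concatMap; length; filter; allFin)
open import Data.Vec.Functional using (Vector) renaming (_∷_ to _◂_)
open import Data.Product using (∃)
open import Relation.Nullary using (¬_; Dec)
open import Relation.Nullary.Decidable using (¬?)
open import Relation.Nullary.Decidable using (_×-dec_)

allFuns : {A : Set} → List A → (n : ℕ) → List (Vector A n)
allFuns xs zero    = (λ ()) ∷ []
allFuns xs (suc n) = concatMap (λ a → map (λ f → a ◂ f) (allFuns xs n)) xs

-- an n×m matrix over ℤ_q (q = p^t), entries represented by Fin q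
Matrix : ℕ → ℕ → ℕ → Set
Matrix n m q = Fin n → Fin m → Fin q

sumFin : (m : ℕ) → (Fin m → ℕ) → ℕ
sumFin zero    f = 0
sumFin (suc m) f = f Fin.zero + sumFin m (λ i → f (Fin.suc i))

IsSolution : {n m q : ℕ} → Matrix n m q → Vector (Fin q) m → Set
IsSolution {n} {m} {q} A x =
  (i : Fin n) → q ∣ sumFin m (λ k → toℕ (A i k) * toℕ (x k))

isSolution? : {n m q : ℕ} (A : Matrix n m q) (x : Vector (Fin q) m) → Dec (IsSolution A x)
isSolution? {n} {m} {q} A x = all? (λ i → q ∣? sumFin m (λ k → toℕ (A i k) * toℕ (x k)))

numSolutions : {n m q : ℕ} → Matrix n m q → ℕ
numSolutions {n} {m} {q} A = length (filter (isSolution? A) (allFuns (allFin q) m))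

allMatrices : (n m q : ℕ) → List (Matrix n m q)
allMatrices n m q = allFuns (allFuns (allFin q) m) n

RelPrime : {n m q : ℕ} → ℕ → Matrix n m q → Set
RelPrime {n} {m} p A = ∃ λ i → ∃ λ k → ¬ (p ∣ toℕ (A i k))

relPrime? : {n m q : ℕ} (p : ℕ) (A : Matrix n m q) → Dec (RelPrime p A)
relPrime? p A = any? (λ i → any? (λ k → ¬? (p ∣? toℕ (A i k))))

-- E(n×m, p^t, p^j); zero for j < 0
E : (n m p t : ℕ) → ℤ → ℕ
E n m p t (+ j)    =
  length (filter (λ A → numSolutions A ≟ p ^ j) (allMatrices n m (p ^ t)))
E n m p t -[1+ _ ] = 0

Ẽ : (n m p s : ℕ) → ℤ → ℕ
Ẽ n m p s (+ j)    =
  length (filter (λ A → relPrime? p A ×-dec (numSolutions A ≟ p ^ j))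
                 (allMatrices n m (p ^ s)))
Ẽ n m p s -[1+ _ ] = 0

-- A matrix over ℤ_{p^s} that is not relatively prime is p·B for a unique matrix B over
-- ℤ_{p^(s-1)}, and p·B x ≡ 0 (mod p^s) holds iff B (x mod p^(s-1)) ≡ 0 (mod p^(s-1)).
-- Every vector mod p^(s-1) has exactly p^m lifts to ℤ_{p^s}^m, so p·B has p^m times as many
-- solutions as B, i.e. p^j solutions exactly when B has p^(j-m).
-- Counts are handled as sums of indicators: the bijection b ↦ p·b onto the multiples of p and the
-- p-to-1 reduction ℤ_{p^s} → ℤ_{p^(s-1)} are weighted-sum identities on single entries, which
-- lift coordinatewise to vectors and matrices.
module Submission where

open import Defs
open import Data.Nat using (ℕ; _+_; _∸_; _≤_)
open import Data.Nat.Primality using (Prime)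
open import Data.Integer using (ℤ; +_; _-_)
open import Relation.Binary.PropositionalEquality using (_≡_)

open import Data.Bool using (true; false; if_then_else_)
open import Data.Fin using (Fin; toℕ)
import Data.Fin.Properties as Fin
open import Data.Integer using (-[1+_])
open import Data.Integer.Properties using (m-n≡m⊖n; ⊖-≥; ⊖-<)
open import Data.List using (List; []; _∷_; _++_; length; filter; allFin; tabulate; concatMap)
import Data.List as List
open import Data.Nat
  using (zero; suc; _*_; _^_; _<_; _≟_; _≤?_; s≤s; z≤n; NonZero; NonTrivial; >-nonZero; nonTrivial⇒n>1; nonTrivial⇒nonZero)
open import Data.Nat.DivMod using (_%_; _/_; _mod_; m≡m%n+[m/n]*n; m<n⇒m%n≡m; %-remove-+ˡ)
open import Data.Nat.Divisibility
  using (_∣_; _∣?_; ∣⇒≤; ∣m+n∣m⇒∣n; ∣m∣n⇒∣m+n; n∣m*n; m∣m*n; *-monoʳ-∣; *-cancelˡ-∣)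
open import Data.Nat.Primality using (prime⇒nonZero; prime⇒nonTrivial)
open import Data.Nat.Properties
open import Algebra.Properties.CommutativeSemigroup +-commutativeSemigroup using (interchange)
open import Data.Product using (_,_; _×_)
open import Data.Vec.Functional using (Vector; map) renaming (_∷_ to _◂_)
open import Data.Vec.Functional.Relation.Binary.Pointwise using (Pointwise)
open import Function using (_∘_; _⇔_; mk⇔; Equivalence)
open import Function.Properties.Equivalence using () renaming (trans to ⇔-trans)
open import Level using (0ℓ)
open import Relation.Binary using (Rel; Reflexive; _Preserves_⟶_)
open import Relation.Binary.PropositionalEquality using (refl; sym; trans; cong; cong₂; subst; module ≡-Reasoning)
open import Relation.Nullary using (¬_; Dec; yes; no; does; _because_; contradiction)
open import Relation.Nullary.Decidable using (_×-dec_; decidable-stable)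
open import Relation.Unary using (Pred; Decidable)

open Equivalence using (to; from)

indicator : {P : Set} → Dec P → ℕ
indicator P? = if does P? then 1 else 0

indicator-yes : {P : Set} (P? : Dec P) → P → indicator P? ≡ 1
indicator-yes (yes _) _ = refl
indicator-yes (no ¬p) p = contradiction p ¬p

indicator-no : {P : Set} (P? : Dec P) → ¬ P → indicator P? ≡ 0
indicator-no (yes p) ¬p = contradiction p ¬p
indicator-no (no _)  _  = refl

indicator-cong : {P Q : Set} (P? : Dec P) (Q? : Dec Q) → P ⇔ Q → indicator P? ≡ indicator Q?
indicator-cong (yes p) Q? P⇔Q = sym (indicator-yes Q? (to P⇔Q p))
indicator-cong (no ¬p) Q? P⇔Q = sym (indicator-no Q? (¬p ∘ from P⇔Q))

indicator-split : {P Q : Set} (P? : Dec P) (Q? : Dec Q) (w : ℕ) → indicator P? + w ≡ 1 →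
                  indicator Q? ≡ indicator (P? ×-dec Q?) + w * indicator Q?
indicator-split (true because _)  Q? zero    _  = sym (+-identityʳ (indicator Q?))
indicator-split (false because _) Q? (suc _) refl = sym (+-identityʳ (indicator Q?))

sumList : {A : Set} → (A → ℕ) → List A → ℕ
sumList h []       = 0
sumList h (x ∷ xs) = h x + sumList h xs

module _ {A : Set} where

  sumList-cong : {g h : A → ℕ} → (∀ x → g x ≡ h x) → ∀ xs → sumList g xs ≡ sumList h xs
  sumList-cong g≗h []       = refl
  sumList-cong g≗h (x ∷ xs) = cong₂ _+_ (g≗h x) (sumList-cong g≗h xs)

  sumList-+ : (g h : A → ℕ) → ∀ xs → sumList (λ x → g x + h x) xs ≡ sumList g xs + sumList h xs
  sumList-+ g h []       = refl
  sumList-+ g h (x ∷ xs) =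
    trans (cong (_+_ (g x + h x)) (sumList-+ g h xs)) (interchange (g x) (h x) _ _)

  sumList-*ˡ : ∀ c (h : A → ℕ) xs → sumList (λ x → c * h x) xs ≡ c * sumList h xs
  sumList-*ˡ c h []       = sym (*-zeroʳ c)
  sumList-*ˡ c h (x ∷ xs) =
    trans (cong (_+_ (c * h x)) (sumList-*ˡ c h xs)) (sym (*-distribˡ-+ c (h x) _))

  sumList-≡0 : (h : A → ℕ) → (∀ x → h x ≡ 0) → ∀ xs → sumList h xs ≡ 0
  sumList-≡0 h h≡0 []       = refl
  sumList-≡0 h h≡0 (x ∷ xs) = cong₂ _+_ (h≡0 x) (sumList-≡0 h h≡0 xs)

  sumList-++ : (h : A → ℕ) → ∀ xs ys → sumList h (xs ++ ys) ≡ sumList h xs + sumList h ys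
  sumList-++ h []       ys = refl
  sumList-++ h (x ∷ xs) ys = trans (cong (_+_ (h x)) (sumList-++ h xs ys)) (sym (+-assoc (h x) _ _))

  length-filter≡sumList : {P : Pred A 0ℓ} (P? : Decidable P) →
                          ∀ xs → length (filter P? xs) ≡ sumList (indicator ∘ P?) xs
  length-filter≡sumList P? []       = refl
  length-filter≡sumList P? (x ∷ xs) with does (P? x)
  ... | true  = cong suc (length-filter≡sumList P? xs)
  ... | false = length-filter≡sumList P? xs

  length-filter-cong : {P Q : Pred A 0ℓ} (P? : Decidable P) (Q? : Decidable Q) → (∀ x → P x ⇔ Q x) →
                       ∀ xs → length (filter P? xs) ≡ length (filter Q? xs)
  length-filter-cong P? Q? P⇔Q xs = begin
    length (filter P? xs)          ≡⟨ length-filter≡sumList P? xs ⟩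
    sumList (indicator ∘ P?) xs    ≡⟨ sumList-cong (λ x → indicator-cong (P? x) (Q? x) (P⇔Q x)) xs ⟩
    sumList (indicator ∘ Q?) xs    ≡⟨ length-filter≡sumList Q? xs ⟨
    length (filter Q? xs)          ∎
    where open ≡-Reasoning

sumList-map : {A B : Set} (h : A → ℕ) (f : B → A) → ∀ xs → sumList h (List.map f xs) ≡ sumList (h ∘ f) xs
sumList-map h f []       = refl
sumList-map h f (x ∷ xs) = cong (_+_ (h (f x))) (sumList-map h f xs)

sumList-allFuns-suc : {A : Set} {n : ℕ} (h : Vector A (suc n) → ℕ) → ∀ xs →
  sumList h (allFuns xs (suc n)) ≡ sumList (λ a → sumList (λ t → h (a ◂ t)) (allFuns xs n)) xs
sumList-allFuns-suc {n = n} h xs = prepend-each xs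
  where
  prepend-each : ∀ ys → sumList h (concatMap (λ a → List.map (a ◂_) (allFuns xs n)) ys) ≡
                        sumList (λ a → sumList (λ t → h (a ◂ t)) (allFuns xs n)) ys
  prepend-each []       = refl
  prepend-each (a ∷ ys) = trans (sumList-++ h (List.map (a ◂_) (allFuns xs n)) _)
                                (cong₂ _+_ (sumList-map h (a ◂_) (allFuns xs n)) (prepend-each ys))

sumRange : ℕ → (ℕ → ℕ) → ℕ
sumRange zero    F = 0
sumRange (suc n) F = F 0 + sumRange n (F ∘ suc)

sumRange-cong : ∀ n {F G : ℕ → ℕ} → (∀ x → x < n → F x ≡ G x) → sumRange n F ≡ sumRange n G
sumRange-cong zero    F≗G = refl
sumRange-cong (suc n) F≗G = cong₂ _+_ (F≗G 0 (s≤s z≤n)) (sumRange-cong n (λ x x<n → F≗G (suc x) (s≤s x<n)))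

sumRange-const : ∀ n c → sumRange n (λ _ → c) ≡ n * c
sumRange-const zero    c = refl
sumRange-const (suc n) c = cong (_+_ c) (sumRange-const n c)

sumRange-+ : ∀ a b F → sumRange (a + b) F ≡ sumRange a F + sumRange b (λ y → F (a + y))
sumRange-+ zero    b F = refl
sumRange-+ (suc a) b F = trans (cong (_+_ (F 0)) (sumRange-+ a b (F ∘ suc))) (sym (+-assoc (F 0) _ _))

sumRange-* : ∀ a b F → sumRange (a * b) F ≡ sumRange a (λ x → sumRange b (λ y → F (x * b + y)))
sumRange-* zero    b F = refl
sumRange-* (suc a) b F = trans (sumRange-+ b (a * b) F) (cong (_+_ (sumRange b F)) (begin
  sumRange (a * b) (λ z → F (b + z))
    ≡⟨ sumRange-* a b _ ⟩
  sumRange a (λ x → sumRange b (λ y → F (b + (x * b + y))))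
    ≡⟨ sumRange-cong a (λ x _ → sumRange-cong b (λ y _ → cong F (sym (+-assoc b (x * b) y)))) ⟩
  sumRange a (λ x → sumRange b (λ y → F (b + x * b + y))) ∎))
  where open ≡-Reasoning

sumRange-head : ∀ n .{{_ : NonZero n}} (F : ℕ → ℕ) → (∀ x → 0 < x → x < n → F x ≡ 0) → sumRange n F ≡ F 0
sumRange-head (suc n) F F≡0 = trans (cong (_+_ (F 0)) (begin
  sumRange n (F ∘ suc)    ≡⟨ sumRange-cong n (λ x x<n → F≡0 (suc x) (s≤s z≤n) (s≤s x<n)) ⟩
  sumRange n (λ _ → 0)    ≡⟨ sumRange-const n 0 ⟩
  n * 0                   ≡⟨ *-zeroʳ n ⟩
  0                       ∎)) (+-identityʳ (F 0))
  where open ≡-Reasoning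

sumList-tabulate : {A : Set} → ∀ n (h : A → ℕ) (f : Fin n → A) (F : ℕ → ℕ) →
                   (∀ i → h (f i) ≡ F (toℕ i)) → sumList h (tabulate f) ≡ sumRange n F
sumList-tabulate zero    h f F hf≗F = refl
sumList-tabulate (suc n) h f F hf≗F =
  cong₂ _+_ (hf≗F Fin.zero) (sumList-tabulate n h (f ∘ Fin.suc) (F ∘ suc) (hf≗F ∘ Fin.suc))

sumFin-cong : ∀ n {f g : Fin n → ℕ} → (∀ i → f i ≡ g i) → sumFin n f ≡ sumFin n g
sumFin-cong zero    f≗g = refl
sumFin-cong (suc n) f≗g = cong₂ _+_ (f≗g Fin.zero) (sumFin-cong n (f≗g ∘ Fin.suc))

sumFin-+ : ∀ n (f g : Fin n → ℕ) → sumFin n (λ i → f i + g i) ≡ sumFin n f + sumFin n g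
sumFin-+ zero    f g = refl
sumFin-+ (suc n) f g =
  trans (cong (_+_ (f Fin.zero + g Fin.zero)) (sumFin-+ n _ _)) (interchange (f Fin.zero) (g Fin.zero) _ _)

sumFin-*ˡ : ∀ n c (f : Fin n → ℕ) → sumFin n (λ i → c * f i) ≡ c * sumFin n f
sumFin-*ˡ zero    c f = sym (*-zeroʳ c)
sumFin-*ˡ (suc n) c f =
  trans (cong (_+_ (c * f Fin.zero)) (sumFin-*ˡ n c _)) (sym (*-distribˡ-+ c (f Fin.zero) _))

prodFin : (n : ℕ) → (Fin n → ℕ) → ℕ
prodFin zero    f = 1
prodFin (suc n) f = f Fin.zero * prodFin n (f ∘ Fin.suc)

prodFin-const : ∀ n c → prodFin n (λ _ → c) ≡ c ^ n
prodFin-const zero    c = refl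
prodFin-const (suc n) c = cong (c *_) (prodFin-const n c)

prodFin-ones : ∀ n (f : Fin n → ℕ) → (∀ i → f i ≡ 1) → prodFin n f ≡ 1
prodFin-ones zero    f f≡1 = refl
prodFin-ones (suc n) f f≡1 = cong₂ _*_ (f≡1 Fin.zero) (prodFin-ones n _ (f≡1 ∘ Fin.suc))

prodFin-zero : ∀ n (f : Fin n → ℕ) i → f i ≡ 0 → prodFin n f ≡ 0
prodFin-zero (suc n) f Fin.zero    fi≡0 = cong (_* prodFin n (f ∘ Fin.suc)) fi≡0
prodFin-zero (suc n) f (Fin.suc i) fi≡0 =
  trans (cong (f Fin.zero *_) (prodFin-zero n _ i fi≡0)) (*-zeroʳ (f Fin.zero))

record SameWeightedSums {A B C : Set} (R : Rel C 0ℓ)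
         (xs : List A) (u : A → ℕ) (f : A → C) (ys : List B) (v : B → ℕ) (g : B → C) : Set where
  constructor sameWeightedSums
  field
    sums-agree : (h : C → ℕ) → h Preserves R ⟶ _≡_ →
                 sumList (λ x → u x * h (f x)) xs ≡ sumList (λ y → v y * h (g y)) ys

open SameWeightedSums

module _ {C : Set} {R : Rel C 0ℓ} (R-refl : Reflexive R) where

  ◂-pointwise : ∀ {n c d} {t t′ : Vector C n} → R c d → Pointwise R t t′ → Pointwise R (c ◂ t) (d ◂ t′)
  ◂-pointwise c≈d t≈t′ Fin.zero    = c≈d
  ◂-pointwise c≈d t≈t′ (Fin.suc i) = t≈t′ i

  map-◂ : ∀ {A : Set} {n} (f : A → C) a (t : Vector A n) → Pointwise R (map f (a ◂ t)) (f a ◂ map f t)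
  map-◂ f a t Fin.zero    = R-refl
  map-◂ f a t (Fin.suc i) = R-refl

  SameWeightedSums-allFuns : ∀ {A B : Set} {xs : List A} {u : A → ℕ} {f : A → C}
                               {ys : List B} {v : B → ℕ} {g : B → C} →
    SameWeightedSums R xs u f ys v g → ∀ n →
    SameWeightedSums (Pointwise R {n}) (allFuns xs n) (λ x → prodFin n (u ∘ x)) (map f)
                                       (allFuns ys n) (λ y → prodFin n (v ∘ y)) (map g)
  sums-agree (SameWeightedSums-allFuns same zero) h h-resp = cong (λ z → 1 * z + 0) (h-resp (λ ()))
  sums-agree (SameWeightedSums-allFuns {xs = xs} {u} {f} {ys} {v} {g} same (suc n)) h h-resp = begin
    sumList (λ x → prodFin (suc n) (u ∘ x) * h (map f x)) (allFuns xs (suc n))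
      ≡⟨ expand u f xs ⟩
    sumList (λ a → u a * sumList (λ t → prodFin n (u ∘ t) * h (f a ◂ map f t)) (allFuns xs n)) xs
      ≡⟨ sumList-cong (λ a → cong (u a *_)
           (sums-agree (SameWeightedSums-allFuns same n) (λ t → h (f a ◂ t)) (h-resp-tail (f a)))) xs ⟩
    sumList (λ a → u a * H (f a)) xs
      ≡⟨ sums-agree same H H-resp ⟩
    sumList (λ b → v b * H (g b)) ys
      ≡⟨ expand v g ys ⟨
    sumList (λ y → prodFin (suc n) (v ∘ y) * h (map g y)) (allFuns ys (suc n)) ∎
    where
    open ≡-Reasoning

    H : C → ℕ
    H c = sumList (λ t → prodFin n (v ∘ t) * h (c ◂ map g t)) (allFuns ys n)

    H-resp : H Preserves R ⟶ _≡_
    H-resp {c} {d} c≈d = sumList-cong (λ t → cong (prodFin n (v ∘ t) *_)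
      (h-resp (◂-pointwise {c = c} {d} {map g t} {map g t} c≈d (λ _ → R-refl)))) (allFuns ys n)

    h-resp-tail : ∀ c → (λ t → h (c ◂ t)) Preserves Pointwise R ⟶ _≡_
    h-resp-tail c {t} {t′} t≈t′ = h-resp (◂-pointwise {c = c} {c} {t} {t′} R-refl t≈t′)

    expand : ∀ {D : Set} (w : D → ℕ) (k : D → C) ds →
      sumList (λ x → prodFin (suc n) (w ∘ x) * h (map k x)) (allFuns ds (suc n)) ≡
      sumList (λ a → w a * sumList (λ t → prodFin n (w ∘ t) * h (k a ◂ map k t)) (allFuns ds n)) ds
    expand w k ds = trans (sumList-allFuns-suc _ ds) (sumList-cong (λ a → trans
      (sumList-cong (λ t → trans (*-assoc (w a) _ _)
                                  (cong (λ z → w a * (prodFin n (w ∘ t) * z)) (h-resp (map-◂ k a t))))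
                    (allFuns ds n))
      (sumList-*ˡ (w a) _ (allFuns ds n))) ds)

toℕ-mod : ∀ x n .{{_ : NonZero n}} → toℕ (x mod n) ≡ x % n
toℕ-mod x n = Fin.toℕ-fromℕ< _

toℕ-mod-id : ∀ {n} .{{_ : NonZero n}} (i : Fin n) → toℕ i mod n ≡ i
toℕ-mod-id {n} i = Fin.toℕ-injective (trans (toℕ-mod (toℕ i) n) (m<n⇒m%n≡m (Fin.toℕ<n i)))

∤m*n+o : ∀ {n o} m → 0 < o → o < n → ¬ n ∣ m * n + o
∤m*n+o m 0<o o<n n∣ = <⇒≱ o<n (∣⇒≤ {{>-nonZero 0<o}} (∣m+n∣m⇒∣n n∣ (n∣m*n m)))

∣m+d*n⇔∣m : ∀ {d} m n → d ∣ m + d * n ⇔ d ∣ m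
∣m+d*n⇔∣m {d} m n = mk⇔
  (λ d∣ → ∣m+n∣m⇒∣n (subst (d ∣_) (+-comm m (d * n)) d∣) (m∣m*n n))
  (λ d∣m → ∣m∣n⇒∣m+n d∣m (m∣m*n n))

_·_ : ∀ {m a b} → Vector (Fin a) m → Vector (Fin b) m → ℕ
_·_ {m} u v = sumFin m (λ k → toℕ (u k) * toℕ (v k))

·-cong : ∀ {m a b} {u u′ : Vector (Fin a) m} {v v′ : Vector (Fin b) m} →
         Pointwise _≡_ u u′ → Pointwise _≡_ v v′ → u · v ≡ u′ · v′
·-cong {m} u≈u′ v≈v′ = sumFin-cong m (λ k → cong₂ (λ a b → toℕ a * toℕ b) (u≈u′ k) (v≈v′ k))

IsSolution-cong : ∀ {n m q} {A A′ : Matrix n m q} {x x′ : Vector (Fin q) m} →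
  Pointwise (Pointwise _≡_) A A′ → Pointwise _≡_ x x′ → IsSolution A x → IsSolution A′ x′
IsSolution-cong {q = q} A≈A′ x≈x′ sol i = subst (q ∣_) (·-cong (A≈A′ i) x≈x′) (sol i)

numSolutions-cong : ∀ {n m q} {A A′ : Matrix n m q} →
  Pointwise (Pointwise _≡_) A A′ → numSolutions A ≡ numSolutions A′
numSolutions-cong {m = m} {q} {A} {A′} A≈A′ =
  length-filter-cong (isSolution? A) (isSolution? A′)
    (λ x → mk⇔ (IsSolution-cong A≈A′ (λ _ → refl)) (IsSolution-cong (λ i k → sym (A≈A′ i k)) (λ _ → refl)))
    (allFuns (allFin q) m)

allDivisibleBy : ∀ {n m q} → ℕ → Matrix n m q → ℕ
allDivisibleBy {n} {m} p A = prodFin n (λ i → prodFin m (λ k → indicator (p ∣? toℕ (A i k))))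

indicator-relPrime+allDivisibleBy≡1 : ∀ {n m q} p (A : Matrix n m q) →
  indicator (relPrime? p A) + allDivisibleBy p A ≡ 1
indicator-relPrime+allDivisibleBy≡1 {n} {m} p A with relPrime? p A
... | yes (i , k , p∤Aik) =
  cong suc (prodFin-zero n _ i (prodFin-zero m _ k (indicator-no (p ∣? toℕ (A i k)) p∤Aik)))
... | no ¬relPrime = prodFin-ones n _ (λ i → prodFin-ones m _ (λ k →
  indicator-yes (p ∣? toℕ (A i k)) (decidable-stable (p ∣? toℕ (A i k)) (λ p∤Aik → ¬relPrime (i , k , p∤Aik)))))

p^m*x≡p^j⇔x≡p^[j∸m] : ∀ p .{{_ : NonZero p}} {m j x} → m ≤ j → p ^ m * x ≡ p ^ j ⇔ x ≡ p ^ (j ∸ m)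
p^m*x≡p^j⇔x≡p^[j∸m] p {m} {j} {x} m≤j = mk⇔
  (λ eq → *-cancelˡ-≡ x _ (p ^ m) {{m^n≢0 p m}} (trans eq p^j≡p^m*p^[j∸m]))
  (λ eq → trans (cong (p ^ m *_) eq) (sym p^j≡p^m*p^[j∸m]))
  where
  p^j≡p^m*p^[j∸m] : p ^ j ≡ p ^ m * p ^ (j ∸ m)
  p^j≡p^m*p^[j∸m] = trans (cong (p ^_) (sym (m+[n∸m]≡n m≤j))) (^-distribˡ-+-* p m (j ∸ m))

p^m*x≢p^j : ∀ p .{{_ : NonTrivial p}} {m j} x → j < m → ¬ p ^ m * x ≡ p ^ j
p^m*x≢p^j p {m} {j} x j<m eq = <⇒≱ (^-monoʳ-< p (nonTrivial⇒n>1 p) j<m)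
  (∣⇒≤ {{m^n≢0 p j {{nonTrivial⇒nonZero p}}}} (subst (p ^ m ∣_) eq (m∣m*n x)))

+j-+m≡+[j∸m] : ∀ {j m} → m ≤ j → + j - + m ≡ + (j ∸ m)
+j-+m≡+[j∸m] {j} {m} m≤j = trans (m-n≡m⊖n j m) (⊖-≥ m≤j)

E-of-negative : ∀ n m p t {j} → j < m → E n m p t (+ j - + m) ≡ 0
E-of-negative n m p t {j} j<m rewrite m-n≡m⊖n j m | ⊖-< j<m with m ∸ j | m<n⇒0<n∸m j<m
... | suc _ | _ = refl

module MultiplicationByP (p : ℕ) .{{_ : NonZero p}} (s : ℕ) where

  r q : ℕ
  r = p ^ s
  q = p ^ suc s

  instance
    r≢0 : NonZero r
    r≢0 = m^n≢0 p s
    q≢0 : NonZero q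
    q≢0 = m^n≢0 p (suc s)

  times-p : Fin r → Fin q
  times-p b = (toℕ b * p) mod q

  reduce : Fin q → Fin r
  reduce a = toℕ a mod r

  toℕ-times-p : ∀ b → toℕ (times-p b) ≡ toℕ b * p
  toℕ-times-p b = trans (toℕ-mod (toℕ b * p) q)
    (m<n⇒m%n≡m (subst (toℕ b * p <_) (*-comm r p) (*-monoˡ-< p (Fin.toℕ<n b))))

  -- Among b·p + c with c < p only c = 0 is a multiple of p, so each multiple of p below q = p·r
  -- is hit once, namely as times-p b.
  times-p-sums : SameWeightedSums _≡_ (allFin q) (λ a → indicator (p ∣? toℕ a)) (λ a → a)
                                      (allFin r) (λ _ → 1) times-p
  sums-agree times-p-sums h _ = begin
    sumList (λ a → indicator (p ∣? toℕ a) * h a) (allFin q)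
      ≡⟨ sumList-tabulate q _ (λ a → a) F
           (λ a → cong (λ b → indicator (p ∣? toℕ a) * h b) (sym (toℕ-mod-id a))) ⟩
    sumRange (p * r) F
      ≡⟨ cong (λ N → sumRange N F) (*-comm p r) ⟩
    sumRange (r * p) F
      ≡⟨ sumRange-* r p F ⟩
    sumRange r (λ b → sumRange p (λ c → F (b * p + c)))
      ≡⟨ sumRange-cong r (λ b _ → only-c≡0-counts b) ⟩
    sumRange r (λ b → h ((b * p) mod q))
      ≡⟨ sumList-tabulate r _ (λ b → b) _ (λ b → *-identityˡ (h (times-p b))) ⟨
    sumList (λ b → 1 * h (times-p b)) (allFin r) ∎
    where
    open ≡-Reasoning
    F : ℕ → ℕ
    F x = indicator (p ∣? x) * h (x mod q)
    only-c≡0-counts : ∀ b → sumRange p (λ c → F (b * p + c)) ≡ h ((b * p) mod q)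
    only-c≡0-counts b = begin
      sumRange p (λ c → F (b * p + c))
        ≡⟨ sumRange-head p _ (λ c 0<c c<p → cong (_* h ((b * p + c) mod q))
                                                  (indicator-no (p ∣? (b * p + c)) (∤m*n+o b 0<c c<p))) ⟩
      F (b * p + 0)
        ≡⟨ cong F (+-identityʳ (b * p)) ⟩
      indicator (p ∣? (b * p)) * h ((b * p) mod q)
        ≡⟨ cong (_* h ((b * p) mod q)) (indicator-yes (p ∣? (b * p)) (n∣m*n b)) ⟩
      1 * h ((b * p) mod q)
        ≡⟨ *-identityˡ _ ⟩
      h ((b * p) mod q) ∎

  reduce-sums : SameWeightedSums _≡_ (allFin q) (λ _ → 1) reduce (allFin r) (λ _ → p) (λ b → b)
  sums-agree reduce-sums h _ = begin
    sumList (λ a → 1 * h (reduce a)) (allFin q)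
      ≡⟨ sumList-tabulate q _ (λ a → a) (λ x → 1 * h (x mod r)) (λ _ → refl) ⟩
    sumRange (p * r) (λ x → 1 * h (x mod r))
      ≡⟨ sumRange-* p r _ ⟩
    sumRange p (λ c → sumRange r (λ b → 1 * h ((c * r + b) mod r)))
      ≡⟨ sumRange-cong p (λ c _ → sumRange-cong r (λ b _ → trans (*-identityˡ _) (cong h (mod-periodic c b)))) ⟩
    sumRange p (λ _ → sumRange r (λ b → h (b mod r)))
      ≡⟨ sumRange-const p _ ⟩
    p * sumRange r (λ b → h (b mod r))
      ≡⟨ cong (p *_) (sumList-tabulate r h (λ b → b) _ (λ b → cong h (sym (toℕ-mod-id b)))) ⟨
    p * sumList h (allFin r)
      ≡⟨ sumList-*ˡ p h (allFin r) ⟨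
    sumList (λ b → p * h b) (allFin r) ∎
    where
    open ≡-Reasoning
    mod-periodic : ∀ c b → (c * r + b) mod r ≡ b mod r
    mod-periodic c b = Fin.toℕ-injective (trans (toℕ-mod (c * r + b) r)
      (trans (%-remove-+ˡ {c * r} b {r} (n∣m*n c)) (sym (toℕ-mod b r))))

  sumList-map-reduce : ∀ m (h : Vector (Fin r) m → ℕ) → h Preserves Pointwise _≡_ ⟶ _≡_ →
    sumList (h ∘ map reduce) (allFuns (allFin q) m) ≡ p ^ m * sumList h (allFuns (allFin r) m)
  sumList-map-reduce m h h-resp = begin
    sumList (h ∘ map reduce) (allFuns (allFin q) m)
      ≡⟨ sumList-cong (λ x → trans (cong (_* h (map reduce x)) (prodFin-ones m _ (λ _ → refl))) (*-identityˡ _))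
                      (allFuns (allFin q) m) ⟨
    sumList (λ x → prodFin m (λ _ → 1) * h (map reduce x)) (allFuns (allFin q) m)
      ≡⟨ sums-agree (SameWeightedSums-allFuns refl reduce-sums m) h h-resp ⟩
    sumList (λ y → prodFin m (λ _ → p) * h y) (allFuns (allFin r) m)
      ≡⟨ sumList-cong (λ y → cong (_* h y) (prodFin-const m p)) (allFuns (allFin r) m) ⟩
    sumList (λ y → p ^ m * h y) (allFuns (allFin r) m)
      ≡⟨ sumList-*ˡ (p ^ m) h (allFuns (allFin r) m) ⟩
    p ^ m * sumList h (allFuns (allFin r) m) ∎
    where open ≡-Reasoning

  sumList-allDivisibleBy : ∀ n m (h : Matrix n m q → ℕ) → h Preserves Pointwise (Pointwise _≡_) ⟶ _≡_ →
    sumList (λ A → allDivisibleBy p A * h A) (allMatrices n m q) ≡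
    sumList (h ∘ map (map times-p)) (allMatrices n m r)
  sumList-allDivisibleBy n m h h-resp = begin
    sumList (λ A → allDivisibleBy p A * h A) (allMatrices n m q)
      ≡⟨ sums-agree (SameWeightedSums-allFuns (λ _ → refl) (SameWeightedSums-allFuns refl times-p-sums m) n) h h-resp ⟩
    sumList (λ B → prodFin n (λ _ → prodFin m (λ _ → 1)) * h (map (map times-p) B)) (allMatrices n m r)
      ≡⟨ sumList-cong (λ B → trans (cong (_* h (map (map times-p) B)) ones) (*-identityˡ _)) (allMatrices n m r) ⟩
    sumList (h ∘ map (map times-p)) (allMatrices n m r) ∎
    where
    open ≡-Reasoning
    ones : prodFin n (λ _ → prodFin m (λ _ → 1)) ≡ 1
    ones = prodFin-ones n _ (λ _ → prodFin-ones m _ (λ _ → refl))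

  times-p-· : ∀ {m c} (b : Vector (Fin r) m) (x : Vector (Fin c) m) → map times-p b · x ≡ p * (b · x)
  times-p-· {m} b x = trans
    (sumFin-cong m (λ k → trans (cong (_* toℕ (x k)) (trans (toℕ-times-p (b k)) (*-comm (toℕ (b k)) p)))
                                (*-assoc p (toℕ (b k)) (toℕ (x k)))))
    (sumFin-*ˡ m p _)

  ·-map-reduce : ∀ {m} (b : Vector (Fin r) m) (x : Vector (Fin q) m) →
    b · x ≡ b · map reduce x + r * sumFin m (λ k → toℕ (b k) * (toℕ (x k) / r))
  ·-map-reduce {m} b x = trans (sumFin-cong m entry) (trans (sumFin-+ m _ _) (cong (_+_ (b · map reduce x)) (sumFin-*ˡ m r _)))
    where
    entry : ∀ k → toℕ (b k) * toℕ (x k) ≡ toℕ (b k) * toℕ (reduce (x k)) + r * (toℕ (b k) * (toℕ (x k) / r))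
    entry k = begin
      B * X                        ≡⟨ cong (B *_) (m≡m%n+[m/n]*n X r) ⟩
      B * (X % r + X / r * r)      ≡⟨ *-distribˡ-+ B (X % r) (X / r * r) ⟩
      B * (X % r) + B * (X / r * r) ≡⟨ cong₂ (λ u v → B * u + v) (sym (toℕ-mod X r))
                                            (trans (sym (*-assoc B (X / r) r)) (*-comm (B * (X / r)) r)) ⟩
      B * toℕ (reduce (x k)) + r * (B * (X / r)) ∎
      where
      open ≡-Reasoning
      B = toℕ (b k)
      X = toℕ (x k)

  q∣times-p·⇔r∣· : ∀ {m c} (b : Vector (Fin r) m) (x : Vector (Fin c) m) → q ∣ map times-p b · x ⇔ r ∣ b · x
  q∣times-p·⇔r∣· b x = mk⇔
    (λ q∣ → *-cancelˡ-∣ p (subst (q ∣_) (times-p-· b x) q∣))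
    (λ r∣ → subst (q ∣_) (sym (times-p-· b x)) (*-monoʳ-∣ p r∣))

  r∣·⇔r∣·map-reduce : ∀ {m} (b : Vector (Fin r) m) (x : Vector (Fin q) m) → r ∣ b · x ⇔ r ∣ b · map reduce x
  r∣·⇔r∣·map-reduce {m} b x = subst (λ z → r ∣ z ⇔ r ∣ b · map reduce x) (sym (·-map-reduce b x))
    (∣m+d*n⇔∣m (b · map reduce x) (sumFin m (λ k → toℕ (b k) * (toℕ (x k) / r))))

  isSolution-times-p⇔ : ∀ {n m} (B : Matrix n m r) (x : Vector (Fin q) m) →
    IsSolution (map (map times-p) B) x ⇔ IsSolution B (map reduce x)
  isSolution-times-p⇔ B x = mk⇔ (λ sol i → to (row i) (sol i)) (λ sol i → from (row i) (sol i))
    where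
    row : ∀ i → q ∣ map times-p (B i) · x ⇔ r ∣ B i · map reduce x
    row i = ⇔-trans (q∣times-p·⇔r∣· (B i) x) (r∣·⇔r∣·map-reduce (B i) x)

  numSolutions-times-p : ∀ {n m} (B : Matrix n m r) → numSolutions (map (map times-p) B) ≡ p ^ m * numSolutions B
  numSolutions-times-p {m = m} B = begin
    numSolutions (map (map times-p) B)
      ≡⟨ length-filter≡sumList (isSolution? (map (map times-p) B)) (allFuns (allFin q) m) ⟩
    sumList (indicator ∘ isSolution? (map (map times-p) B)) (allFuns (allFin q) m)
      ≡⟨ sumList-cong (λ x → indicator-cong (isSolution? (map (map times-p) B) x) (isSolution? B (map reduce x))
                                            (isSolution-times-p⇔ B x))
                      (allFuns (allFin q) m) ⟩
    sumList (indicator ∘ isSolution? B ∘ map reduce) (allFuns (allFin q) m)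
      ≡⟨ sumList-map-reduce m _ solution-resp ⟩
    p ^ m * sumList (indicator ∘ isSolution? B) (allFuns (allFin r) m)
      ≡⟨ cong (p ^ m *_) (length-filter≡sumList (isSolution? B) (allFuns (allFin r) m)) ⟨
    p ^ m * numSolutions B ∎
    where
    open ≡-Reasoning
    solution-resp : (indicator ∘ isSolution? B) Preserves Pointwise _≡_ ⟶ _≡_
    solution-resp {x} {y} x≈y = indicator-cong (isSolution? B x) (isSolution? B y)
      (mk⇔ (IsSolution-cong {A = B} (λ _ _ → refl) x≈y) (IsSolution-cong {A = B} (λ _ _ → refl) (sym ∘ x≈y)))

  E-suc≡scaled-count+Ẽ : ∀ n m j → E n m p (suc s) (+ j) ≡
    sumList (λ B → indicator (p ^ m * numSolutions B ≟ p ^ j)) (allMatrices n m r) + Ẽ n m p (suc s) (+ j)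
  E-suc≡scaled-count+Ẽ n m j = begin
    E n m p (suc s) (+ j)
      ≡⟨ length-filter≡sumList (λ A → numSolutions A ≟ p ^ j) (allMatrices n m q) ⟩
    sumList hits (allMatrices n m q)
      ≡⟨ sumList-cong (λ A → indicator-split (relPrime? p A) (numSolutions A ≟ p ^ j) (allDivisibleBy p A)
                               (indicator-relPrime+allDivisibleBy≡1 p A)) (allMatrices n m q) ⟩
    sumList (λ A → indicator (relPrime-hit? A) + allDivisibleBy p A * hits A)
            (allMatrices n m q)
      ≡⟨ sumList-+ (indicator ∘ relPrime-hit?)
                   (λ A → allDivisibleBy p A * hits A) (allMatrices n m q) ⟩
    sumList (indicator ∘ relPrime-hit?) (allMatrices n m q) +
    sumList (λ A → allDivisibleBy p A * hits A) (allMatrices n m q)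
      ≡⟨ cong₂ _+_ (sym (length-filter≡sumList relPrime-hit? (allMatrices n m q)))
                   (sumList-allDivisibleBy n m hits hits-resp) ⟩
    Ẽ n m p (suc s) (+ j) + sumList (hits ∘ map (map times-p)) (allMatrices n m r)
      ≡⟨ +-comm (Ẽ n m p (suc s) (+ j)) _ ⟩
    sumList (hits ∘ map (map times-p)) (allMatrices n m r) + Ẽ n m p (suc s) (+ j)
      ≡⟨ cong (_+ Ẽ n m p (suc s) (+ j)) (sumList-cong (λ B →
           cong (λ N → indicator (N ≟ p ^ j)) (numSolutions-times-p B)) (allMatrices n m r)) ⟩
    sumList (λ B → indicator (p ^ m * numSolutions B ≟ p ^ j)) (allMatrices n m r) + Ẽ n m p (suc s) (+ j) ∎
    where
    open ≡-Reasoning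
    hits : Matrix n m q → ℕ
    hits A = indicator (numSolutions A ≟ p ^ j)
    relPrime-hit? : (A : Matrix n m q) → Dec (RelPrime p A × numSolutions A ≡ p ^ j)
    relPrime-hit? A = relPrime? p A ×-dec (numSolutions A ≟ p ^ j)
    hits-resp : hits Preserves Pointwise (Pointwise _≡_) ⟶ _≡_
    hits-resp A≈A′ = cong (λ N → indicator (N ≟ p ^ j)) (numSolutions-cong A≈A′)

  scaled-count≡E : .{{_ : NonTrivial p}} → ∀ n m j →
    sumList (λ B → indicator (p ^ m * numSolutions B ≟ p ^ j)) (allMatrices n m r) ≡ E n m p s (+ j - + m)
  scaled-count≡E n m j with m ≤? j
  ... | yes m≤j rewrite +j-+m≡+[j∸m] m≤j = trans
    (sym (length-filter≡sumList (λ B → p ^ m * numSolutions B ≟ p ^ j) (allMatrices n m r)))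
    (length-filter-cong (λ B → p ^ m * numSolutions B ≟ p ^ j) (λ B → numSolutions B ≟ p ^ (j ∸ m))
                        (λ _ → p^m*x≡p^j⇔x≡p^[j∸m] p m≤j) (allMatrices n m r))
  ... | no m≰j = trans
    (sumList-≡0 _ (λ B → indicator-no (p ^ m * numSolutions B ≟ p ^ j) (p^m*x≢p^j p (numSolutions B) (≰⇒> m≰j)))
                (allMatrices n m r))
    (sym (E-of-negative n m p s (≰⇒> m≰j)))

proposition3p4 : (p : ℕ) → Prime p → (s n m : ℕ) → 1 ≤ s → 1 ≤ n → 1 ≤ m → (j : ℤ) →
    E n m p s j ≡ E n m p (s ∸ 1) (j - + m) + Ẽ n m p s j
proposition3p4 p p-prime (suc s) n m _ _ _ (+ j) =
  trans (E-suc≡scaled-count+Ẽ n m j) (cong (_+ Ẽ n m p (suc s) (+ j)) (scaled-count≡E n m j))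
  where
  instance
    p≢0 : NonZero p
    p≢0 = prime⇒nonZero p-prime
    p-nonTrivial : NonTrivial p
    p-nonTrivial = prime⇒nonTrivial p-prime
  open MultiplicationByP p s
proposition3p4 p _ (suc s) n zero    _ _ _ -[1+ j ] = refl
proposition3p4 p _ (suc s) n (suc m) _ _ _ -[1+ j ] = refl
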